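{- Let $P$ be a normal logic program. If $I_1$ and $I_2$ are two distinct $\le_s$-minimal stable trap spaces of $P$, then $I_1$ and $I_2$ are not consistent, i.e., $[I_1]\cap[I_2]=\emptyset$. The same holds for two distinct $\le_s$-minimal supported trap spaces of $P$.
   Context: Fix a first-order language with finitely many constant, function and predicate symbols. A normal logic program (NLP) $P$ is a finite set of rules $p \leftarrow p_1,\dots,p_m, \mathord{\sim} p_{m+1},\dots,\mathord{\sim} p_k$ ($k\ge m\ge 0$). $\mathrm{HB}(P)$ is its Herbrand base (possibly infinite), $\mathrm{gr}(P)$ its ground instantiation; for a ground rule $r$, $B^+(r)$, $B^-(r)$ are the positive and negative body atoms and $\mathrm{bf}(r)=\bigwedge_{v\in B^+(r)}v\wedge\bigwedge_{v\in B^-(r)}\neg v$. A three-valued interpretation is a map $I:\mathrm{HB}(P)\to\{0,1,\star\}$; two-valued ones (no $\star$) are identified with subsets of $\mathrm{HB}(P)$. $[I]=\{J\subseteq\mathrm{HB}(P): \forall a,\ I(a)\ne\star\Rightarrow J(a)=I(a)\}$. $\le_s$ is the pointwise order with $0<_s\star$, $1<_s\star$ only. Two three-valued interpretations $I_1,I_2$ are consistent if $[I_1]\cap[I_2]\neq\emptyset$. For two-valued $I$: $F_P(I)$ is the $\subseteq$-least model of the Gelfond–Lifschitz reduct of $\mathrm{gr}(P)$ w.r.t. $I$ (delete rules with some $b\in B^-(r)\cap I$, then delete remaining negative literals); $T_P(I)$ is the set of atoms $a$ such that $I$ satisfies $\mathrm{bf}(r)$ for some $r\in\mathrm{gr}(P)$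 with head $a$. A nonempty set $S$ of two-valued interpretations is a stable (resp. supported) trap set if $\{F_P(J):J\in S\}\subseteq S$ (resp. $\{T_P(J):J\in S\}\subseteq S$). A three-valued $I$ is a stable (resp. supported) trap space if $[I]$ is a stable (resp. supported) trap set; it is $\le_s$-minimal if no other stable (resp. supported) trap space $J$ satisfies $J\le_s I$. -}

module Defs where

open import Data.Nat using (ℕ)
open import Data.Fin using (Fin)
open import Data.Vec using (Vec; []; _∷_)
open import Data.List using (List; map)
open import Data.List.Membership.Propositional using (_∈_)
open import Data.List.Relation.Unary.All using (All)
open import Data.Empty using (⊥)
open import Data.Product using (Σ; Σ-syntax; _×_)
open import Data.Sum using (_⊎_)
open import Relation.Nullary using (¬_)
open import Relation.Binary.PropositionalEquality using (_≡_; _≢_)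
open import Level using () renaming (suc to lsuc; zero to lzero)

record Signature : Set where
  field
    nConst : ℕ
    nFun   : ℕ
    nPred  : ℕ
    funAr  : Fin nFun → ℕ
    predAr : Fin nPred → ℕ

module _ (L : Signature) where
  open Signature L

  data Term (V : Set) : Set where
    var : V → Term V
    con : Fin nConst → Term V
    fun : (f : Fin nFun) → Vec (Term V) (funAr f) → Term V

  record Atom (V : Set) : Set where
    constructor atom
    field
      pred : Fin nPred
      args : Vec (Term V) (predAr pred)

  Var : Set
  Var = ℕ

  -- ground terms / ground atoms (the Herbrand base HB(P) = GAtom)
  GTerm : Set
  GTerm = Term ⊥

  GAtom : Set
  GAtom = Atom ⊥

  Subst : Set
  Subst = Var → GTerm

  mutual
    substT : Subst → Term Var → GTerm
    substT σ (var x)    = σ x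
    substT σ (con c)    = con c
    substT σ (fun f ts) = fun f (substTs σ ts)

    substTs : ∀ {n} → Subst → Vec (Term Var) n → Vec GTerm n
    substTs σ []       = []
    substTs σ (t ∷ ts) = substT σ t ∷ substTs σ ts

  substA : Subst → Atom Var → GAtom
  substA σ (atom p ts) = atom p (substTs σ ts)

  record Rule (A : Set) : Set where
    constructor rule
    field
      head : A
      pos  : List A
      neg  : List A
  open Rule public

  NLP : Set
  NLP = List (Rule (Atom Var))

  GRule : Set
  GRule = Rule GAtom

  groundRule : Subst → Rule (Atom Var) → GRule
  groundRule σ r = rule (substA σ (head r)) (map (substA σ) (pos r)) (map (substA σ) (neg r))

  gr : NLP → GRule → Set
  gr P g = Σ[ r ∈ Rule (Atom Var) ] Σ[ σ ∈ Subst ] (r ∈ P × g ≡ groundRule σ r)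

  Interp2 : Set₁
  Interp2 = GAtom → Set

  data TV : Set where
    𝟘 𝟙 ⋆ : TV

  Interp3 : Set
  Interp3 = GAtom → TV

  ⟦_⟧ : Interp3 → Interp2 → Set
  ⟦ I ⟧ J = ∀ a → (I a ≡ 𝟙 → J a) × (I a ≡ 𝟘 → ¬ J a)

  _≤s_ : Interp3 → Interp3 → Set
  I ≤s J = ∀ a → I a ≡ J a ⊎ J a ≡ ⋆

  Consistent : Interp3 → Interp3 → Set₁
  Consistent I₁ I₂ = Σ[ J ∈ Interp2 ] (⟦ I₁ ⟧ J × ⟦ I₂ ⟧ J)

  -- definite ground rules (head, positive body)
  DefRule : Set
  DefRule = GAtom × List GAtom

  reduct : NLP → Interp2 → DefRule → Set
  reduct P I (h Data.Product., ps) =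
    Σ[ g ∈ GRule ] (gr P g × All (λ b → ¬ I b) (neg g) × h ≡ head g × ps ≡ pos g)

  data LeastModel (R : DefRule → Set) : GAtom → Set where
    derive : ∀ h ps → R (h Data.Product., ps) → All (LeastModel R) ps → LeastModel R h

  F : NLP → Interp2 → Interp2
  F P I = LeastModel (reduct P I)

  SatBody : Interp2 → GRule → Set
  SatBody I g = All I (pos g) × All (λ b → ¬ I b) (neg g)

  T : NLP → Interp2 → Interp2
  T P I a = Σ[ g ∈ GRule ] (gr P g × head g ≡ a × SatBody I g)

  TrapSet : (Interp2 → Interp2) → (Interp2 → Set) → Set₁
  TrapSet O S = (Σ[ J ∈ Interp2 ] S J) × (∀ J → S J → S (O J))

  StableTrapSpace : NLP → Interp3 → Set₁
  StableTrapSpace P I = TrapSet (F P) ⟦ I ⟧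

  SupportedTrapSpace : NLP → Interp3 → Set₁
  SupportedTrapSpace P I = TrapSet (T P) ⟦ I ⟧

  Minimal : (Interp3 → Set₁) → Interp3 → Set₁
  Minimal Trap I = Trap I × ¬ (Σ[ J ∈ Interp3 ] (Trap J × J ≤s I × J ≢ I))

{-# OPTIONS --safe #-}
-- If [I₁] and [I₂] meet, the pointwise meet I₁ ⊓ I₂ of the two three-valued
-- interpretations satisfies [I₁ ⊓ I₂] = [I₁] ∩ [I₂] and lies ≤s-below both.
-- An intersection of two trap sets with a common element is again a trap set,
-- so I₁ ⊓ I₂ is a trap space, and minimality forces I₁ = I₁ ⊓ I₂ = I₂.
-- Nothing about F or T beyond being operators on two-valued interpretations
-- is used.
module Submission where

open import Defs
open import Data.Product using (_×_; _,_; proj₁; proj₂)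
open import Data.Sum using (_⊎_; inj₁; inj₂)
open import Data.Empty using (⊥-elim)
open import Relation.Nullary using (¬_)
open import Relation.Binary.PropositionalEquality using (_≡_; _≢_; refl; sym; trans)

module _ {L : Signature} where

  Admits : TV L → Set → Set
  Admits x A = (x ≡ 𝟙 → A) × (x ≡ 𝟘 → ¬ A)

  -- On the conflicting pairs 𝟘/𝟙 the result is junk (the left value);
  -- the lemmas below only use it on values admitting a common truth value.
  _⊓_ : TV L → TV L → TV L
  𝟘 ⊓ y = 𝟘
  𝟙 ⊓ y = 𝟙
  ⋆ ⊓ y = y

  admits-⊓ : ∀ x y {A} → Admits x A → Admits y A → Admits (x ⊓ y) A
  admits-⊓ 𝟘 y ax ay = ax
  admits-⊓ 𝟙 y ax ay = ax
  admits-⊓ ⋆ y ax ay = ay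

  admits-⊓ˡ : ∀ x y {A} → Admits (x ⊓ y) A → Admits x A
  admits-⊓ˡ 𝟘 y a = a
  admits-⊓ˡ 𝟙 y a = a
  admits-⊓ˡ ⋆ y a = (λ ()) , (λ ())

  admits-⊓ʳ : ∀ x y {A B} → Admits x B → Admits y B → Admits (x ⊓ y) A → Admits y A
  admits-⊓ʳ 𝟘 𝟘 bx by a = a
  admits-⊓ʳ 𝟘 𝟙 bx by a = ⊥-elim (proj₂ bx refl (proj₁ by refl))
  admits-⊓ʳ 𝟘 ⋆ bx by a = (λ ()) , (λ ())
  admits-⊓ʳ 𝟙 𝟘 bx by a = ⊥-elim (proj₂ by refl (proj₁ bx refl))
  admits-⊓ʳ 𝟙 𝟙 bx by a = a
  admits-⊓ʳ 𝟙 ⋆ bx by a = (λ ()) , (λ ())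
  admits-⊓ʳ ⋆ y bx by a = a

  ⊓-≤ˡ : ∀ x y → x ⊓ y ≡ x ⊎ x ≡ ⋆
  ⊓-≤ˡ 𝟘 y = inj₁ refl
  ⊓-≤ˡ 𝟙 y = inj₁ refl
  ⊓-≤ˡ ⋆ y = inj₂ refl

  ⊓-≤ʳ : ∀ x y {B} → Admits x B → Admits y B → x ⊓ y ≡ y ⊎ y ≡ ⋆
  ⊓-≤ʳ 𝟘 𝟘 bx by = inj₁ refl
  ⊓-≤ʳ 𝟘 𝟙 bx by = ⊥-elim (proj₂ bx refl (proj₁ by refl))
  ⊓-≤ʳ 𝟘 ⋆ bx by = inj₂ refl
  ⊓-≤ʳ 𝟙 𝟘 bx by = ⊥-elim (proj₂ by refl (proj₁ bx refl))
  ⊓-≤ʳ 𝟙 𝟙 bx by = inj₁ refl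
  ⊓-≤ʳ 𝟙 ⋆ bx by = inj₂ refl
  ⊓-≤ʳ ⋆ y bx by = inj₁ refl

  _⊓ᴵ_ : Interp3 L → Interp3 L → Interp3 L
  (I₁ ⊓ᴵ I₂) a = I₁ a ⊓ I₂ a

  module _ {I₁ I₂ : Interp3 L} where

    ⟦⊓⟧-intro : ∀ {K} → ⟦_⟧ L I₁ K → ⟦_⟧ L I₂ K → ⟦_⟧ L (I₁ ⊓ᴵ I₂) K
    ⟦⊓⟧-intro k₁ k₂ a = admits-⊓ (I₁ a) (I₂ a) (k₁ a) (k₂ a)

    ⟦⊓⟧-elimˡ : ∀ {K} → ⟦_⟧ L (I₁ ⊓ᴵ I₂) K → ⟦_⟧ L I₁ K
    ⟦⊓⟧-elimˡ k a = admits-⊓ˡ (I₁ a) (I₂ a) (k a)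

    ⟦⊓⟧-elimʳ : Consistent L I₁ I₂ → ∀ {K} → ⟦_⟧ L (I₁ ⊓ᴵ I₂) K → ⟦_⟧ L I₂ K
    ⟦⊓⟧-elimʳ (J , j₁ , j₂) k a = admits-⊓ʳ (I₁ a) (I₂ a) (j₁ a) (j₂ a) (k a)

    ⊓ᴵ-≤sˡ : _≤s_ L (I₁ ⊓ᴵ I₂) I₁
    ⊓ᴵ-≤sˡ a = ⊓-≤ˡ (I₁ a) (I₂ a)

    ⊓ᴵ-≤sʳ : Consistent L I₁ I₂ → _≤s_ L (I₁ ⊓ᴵ I₂) I₂
    ⊓ᴵ-≤sʳ (J , j₁ , j₂) a = ⊓-≤ʳ (I₁ a) (I₂ a) (j₁ a) (j₂ a)

    trapSpace-⊓ᴵ : ∀ {O} → TrapSet L O (⟦_⟧ L I₁) → TrapSet L O (⟦_⟧ L I₂) →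
      Consistent L I₁ I₂ → TrapSet L O (⟦_⟧ L (I₁ ⊓ᴵ I₂))
    trapSpace-⊓ᴵ (_ , trap₁) (_ , trap₂) c@(J , j₁ , j₂) =
      (J , ⟦⊓⟧-intro j₁ j₂) ,
      λ K k → ⟦⊓⟧-intro (trap₁ K (⟦⊓⟧-elimˡ k)) (trap₂ K (⟦⊓⟧-elimʳ c k))

  distinct-minimal⇒inconsistent : (Trap : Interp3 L → Set₁) →
    (∀ {I₁ I₂} → Trap I₁ → Trap I₂ → Consistent L I₁ I₂ → Trap (I₁ ⊓ᴵ I₂)) →
    ∀ {I₁ I₂} → I₁ ≢ I₂ → Minimal L Trap I₁ → Minimal L Trap I₂ → ¬ Consistent L I₁ I₂
  distinct-minimal⇒inconsistent Trap trap-⊓ {I₁} {I₂} I₁≢I₂ (t₁ , min₁) (t₂ , min₂) c =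
    min₁ (I₁ ⊓ᴵ I₂ , t , ⊓ᴵ-≤sˡ , λ eq₁ →
    min₂ (I₁ ⊓ᴵ I₂ , t , ⊓ᴵ-≤sʳ c , λ eq₂ →
    I₁≢I₂ (trans (sym eq₁) eq₂)))
    where
    t : Trap (I₁ ⊓ᴵ I₂)
    t = trap-⊓ t₁ t₂ c

proposition3p3 : (L : Signature) (P : NLP L) (I₁ I₂ : Interp3 L) → I₁ ≢ I₂ →
    ((Minimal L (StableTrapSpace L P) I₁ → Minimal L (StableTrapSpace L P) I₂ → ¬ Consistent L I₁ I₂)
    × (Minimal L (SupportedTrapSpace L P) I₁ → Minimal L (SupportedTrapSpace L P) I₂ → ¬ Consistent L I₁ I₂))
proposition3p3 L P I₁ I₂ I₁≢I₂ =
  distinct-minimal⇒inconsistent (StableTrapSpace L P) trapSpace-⊓ᴵ I₁≢I₂ ,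
  distinct-minimal⇒inconsistent (SupportedTrapSpace L P) trapSpace-⊓ᴵ I₁≢I₂
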